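{- Let $d : p \to_{\beta_f}^* q$ be a normalising evaluation in the split fireball calculus (i.e. $q$ is a normal program). Then there exist a type context $\Gamma$, a multi type $M$ and a type derivation $\pi \triangleright \Gamma \vdash p : M$, and it satisfies $|d| + |q| \leq |\pi|$.
   Context: Terms: $t,u ::= x \mid \lambda x.t \mid tu$, up to $\alpha$-equivalence; $t\{x\leftarrow u\}$ is capture-avoiding substitution. Values: $v ::= x \mid \lambda x.t$. Fireballs $f$ and inert terms $i$ are defined by mutual induction: $f ::= v \mid i$ and $i ::= x f_1 \dots f_n$ with $n>0$ (application left-associative). Right evaluation contexts: $C ::= \langle\cdot\rangle \mid t\,C \mid C\,f$. Split fireball calculus: environments $E ::= \epsilon \mid [x\leftarrow i]:E$; programs are pairs $p=(t,E)$. Reduction on programs: $(C\langle(\lambda x.t)v\rangle,E)\to_{\beta_v}(C\langle t\{x\leftarrow v\}\rangle,E)$ and $(C\langle(\lambda x.t)i\rangle,E)\to_{\beta_i}(C\langle t\rangle,[x\leftarrow i]:E)$; $\to_{\beta_f}=\to_{\beta_v}\cup\to_{\beta_i}$. A program is normal if it has no $\to_{\beta_f}$-reduct. For an evaluation $d$, $|d|$ is its number of steps. Append: $\epsilon@[x\leftarrow i]=[x\leftarrow i]$, $([y\leftarrow i']:E)@[x\leftarrow i]=[y\leftarrow i']:(E@[x\leftarrow i])$. Sizes: $|v|=0$, $|tu|=|t|+|u|+1$, $|(t,\epsilon)|=|t|$, $|(t,E@[x\leftarrow i])|=|(t,E)|+|i|$. Multi types: linear types $L ::= M\multimap N$; multi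 types $M,N ::= [L_1,\dots,L_n]$ (finite multisets, $n\ge 0$); $\mathbf 0$ is the empty multiset, $\uplus$ multiset sum. A type context $\Gamma$ is a total map from variables to multi types with finite $\mathrm{dom}(\Gamma)=\{x\mid \Gamma(x)\ne\mathbf 0\}$; $(\Gamma\uplus\Delta)(x)=\Gamma(x)\uplus\Delta(x)$; $x:M$ maps $x$ to $M$ and all else to $\mathbf 0$; $\Gamma,x:M$ extends $\Gamma$ (with $x\notin\mathrm{dom}(\Gamma)$) by $x\mapsto M$. Typing rules: (ax) $x:M\vdash x:M$; (@) from $\Gamma\vdash t:[M\multimap N]$ and $\Delta\vdash u:M$ infer $\Gamma\uplus\Delta\vdash tu:N$; ($\lambda$) from $\Gamma_k,x:M_k\vdash t:N_k$ for $k=1,\dots,n$ ($n\ge0$) infer $\Gamma_1\uplus\dots\uplus\Gamma_n\vdash\lambda x.t:[M_1\multimap N_1,\dots,M_n\multimap N_n]$; (es$_\epsilon$) from $\Gamma\vdash t:M$ infer $\Gamma\vdash (t,\epsilon):M$; (es$_@$) from $\Gamma,x:M\vdash(t,E):N$ and $\Delta\vdash i:M$ infer $\Gamma\uplus\Delta\vdash(t,E@[x\leftarrow i]):N$. $|\pi|$ is the number of (@) rules in a derivation $\pi$. -}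

module Defs where

open import Data.Nat using (ℕ; zero; suc; _+_; _≤_)
open import Data.Fin using (Fin; zero; suc)
open import Data.List using (List; []; _∷_; _++_; [_])
open import Data.List.Relation.Binary.Permutation.Homogeneous using (Permutation)
open import Data.Product using (Σ; _,_)
open import Relation.Nullary using (¬_)

data Tm (n : ℕ) : Set where
  var : Fin n → Tm n
  lam : Tm (suc n) → Tm n
  _·_ : Tm n → Tm n → Tm n

infixl 7 _·_

ext : ∀ {n m} → (Fin n → Fin m) → Fin (suc n) → Fin (suc m)
ext ρ zero    = zero
ext ρ (suc x) = suc (ρ x)

ren : ∀ {n m} → (Fin n → Fin m) → Tm n → Tm m
ren ρ (var x) = var (ρ x)
ren ρ (lam t) = lam (ren (ext ρ) t)
ren ρ (t · u) = ren ρ t · ren ρ u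

exts : ∀ {n m} → (Fin n → Tm m) → Fin (suc n) → Tm (suc m)
exts σ zero    = var zero
exts σ (suc x) = ren suc (σ x)

sub : ∀ {n m} → (Fin n → Tm m) → Tm n → Tm m
sub σ (var x) = σ x
sub σ (lam t) = lam (sub (exts σ) t)
sub σ (t · u) = sub σ t · sub σ u

-- t{x←u}, where x is the variable bound by the enclosing λ (index 0)
single : ∀ {n} → Tm n → Fin (suc n) → Tm n
single u zero    = u
single u (suc x) = var x

_⟨_⟩ : ∀ {n} → Tm (suc n) → Tm n → Tm n
t ⟨ u ⟩ = sub (single u) t

data Value {n : ℕ} : Tm n → Set where
  v-var : (x : Fin n) → Value (var x)
  v-lam : (t : Tm (suc n)) → Value (lam t)

mutual
  data Fireball {n : ℕ} : Tm n → Set where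
    f-val   : ∀ {t} → Value t → Fireball t
    f-inert : ∀ {t} → Inert t → Fireball t

  data Inert {n : ℕ} : Tm n → Set where
    i-var : ∀ (x : Fin n) {f} → Fireball f → Inert (var x · f)
    i-app : ∀ {i f} → Inert i → Fireball f → Inert (i · f)

data Ctx (n : ℕ) : Set where
  hole : Ctx n
  _·ᶜ_ : Tm n → Ctx n → Ctx n
  _ᶜ·_ : Ctx n → Tm n → Ctx n

data EvalCtx {n : ℕ} : Ctx n → Set where
  e-hole : EvalCtx hole
  e-right : ∀ t {C} → EvalCtx C → EvalCtx (t ·ᶜ C)
  e-left : ∀ {C f} → EvalCtx C → Fireball f → EvalCtx (C ᶜ· f)

plug : ∀ {n} → Ctx n → Tm n → Tm n
plug hole      s = s
plug (t ·ᶜ C)  s = t · plug C s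
plug (C ᶜ· u)  s = plug C s · u

renC : ∀ {n m} → (Fin n → Fin m) → Ctx n → Ctx m
renC ρ hole     = hole
renC ρ (t ·ᶜ C) = ren ρ t ·ᶜ renC ρ C
renC ρ (C ᶜ· u) = renC ρ C ᶜ· ren ρ u

-- A program (t , E) whose free variables live in scope n.
-- ⟪ t ⟫            is  (t , ε)
-- es p i ii        is  (t , E @ [x ← i])  where p = (t , E) has the
--                  extra variable x (index 0) in scope, i is inert.

data Prog : ℕ → Set where
  ⟪_⟫ : ∀ {n} → Tm n → Prog n
  es  : ∀ {n} → Prog (suc n) → (i : Tm n) → Inert i → Prog n

data _⟶_ : ∀ {n} → Prog n → Prog n → Set where
  βv : ∀ {n} {C : Ctx n} {t : Tm (suc n)} {v : Tm n} →
       EvalCtx C → Value v →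
       ⟪ plug C (lam t · v) ⟫ ⟶ ⟪ plug C (t ⟨ v ⟩) ⟫
  -- (C⟨(λx.t) i⟩ , ε) → (C⟨t⟩ , [x←i])   (x fresh: C is weakened)
  βi : ∀ {n} {C : Ctx n} {t : Tm (suc n)} {i : Tm n} →
       EvalCtx C → (ii : Inert i) →
       ⟪ plug C (lam t · i) ⟫ ⟶ es ⟪ plug (renC suc C) t ⟫ i ii
  under : ∀ {n} {p p' : Prog (suc n)} {j : Tm n} {jj : Inert j} →
       p ⟶ p' → es p j jj ⟶ es p' j jj

Normal : ∀ {n} → Prog n → Set
Normal p = ¬ (Σ (Prog _) λ q → p ⟶ q)

data _⟶*_ {n : ℕ} : Prog n → Prog n → Set where
  done : ∀ {p} → p ⟶* p
  step : ∀ {p q r} → p ⟶ q → q ⟶* r → p ⟶* r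

len : ∀ {n} {p q : Prog n} → p ⟶* q → ℕ
len done       = 0
len (step _ d) = suc (len d)

tsize : ∀ {n} → Tm n → ℕ
tsize (var _) = 0
tsize (lam _) = 0
tsize (t · u) = tsize t + tsize u + 1

psize : ∀ {n} → Prog n → ℕ
psize ⟪ t ⟫       = tsize t
psize (es p i _)  = psize p + tsize i

-- Multi types.  Multisets are lists, compared up to permutation
-- (recursively, since linear types contain multisets).

data LTy : Set where
  _⊸_ : List LTy → List LTy → LTy

MTy : Set
MTy = List LTy

𝟎 : MTy
𝟎 = []

mutual
  data _≈L_ : LTy → LTy → Set where
    ⊸-cong : ∀ {M M' N N'} → Permutation _≈L_ M M' → Permutation _≈L_ N N' →
             (M ⊸ N) ≈L (M' ⊸ N')

_≈M_ : MTy → MTy → Set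
M ≈M N = Permutation _≈L_ M N

-- type contexts on scope n (total maps; finite domain automatic)
TyCtx : ℕ → Set
TyCtx n = Fin n → MTy

_⊎ᶜ_ : ∀ {n} → TyCtx n → TyCtx n → TyCtx n
(Γ ⊎ᶜ Δ) x = Γ x ++ Δ x

emptyᶜ : ∀ {n} → TyCtx n
emptyᶜ _ = 𝟎

_↦_ : ∀ {n} → Fin n → MTy → TyCtx n
(zero ↦ M) zero    = M
(zero ↦ M) (suc y) = 𝟎
(suc x ↦ M) zero    = 𝟎
(suc x ↦ M) (suc y) = (x ↦ M) y

-- a context Γ' on scope suc n is "Γ , x : M" with Γ = tailᶜ Γ', M = Γ' zero
tailᶜ : ∀ {n} → TyCtx (suc n) → TyCtx n
tailᶜ Γ x = Γ (suc x)

mutual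
  data _⊢_∶_ {n : ℕ} : TyCtx n → Tm n → MTy → Set where
    ax  : (x : Fin n) (M : MTy) → (x ↦ M) ⊢ var x ∶ M
    app : ∀ {Γ Δ t u M M' N} →
          Γ ⊢ t ∶ [ M ⊸ N ] → Δ ⊢ u ∶ M' → M ≈M M' →
          (Γ ⊎ᶜ Δ) ⊢ t · u ∶ N
    abs : ∀ {Γ t L} → LamPremises t Γ L → Γ ⊢ lam t ∶ L

  -- the k = 1..n premises  Γₖ , x : Mₖ ⊢ t : Nₖ  of rule (λ)
  data LamPremises {n : ℕ} (t : Tm (suc n)) : TyCtx n → MTy → Set where
    lnil  : LamPremises t emptyᶜ []
    lcons : ∀ {Γ' Δ N L} → Γ' ⊢ t ∶ N → LamPremises t Δ L →
            LamPremises t (tailᶜ Γ' ⊎ᶜ Δ) ((Γ' zero ⊸ N) ∷ L)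

mutual
  nApp : ∀ {n Γ} {t : Tm n} {M} → Γ ⊢ t ∶ M → ℕ
  nApp (ax _ _)      = 0
  nApp (app π σ _)   = suc (nApp π + nApp σ)
  nApp (abs ps)      = nAppL ps

  nAppL : ∀ {n Γ} {t : Tm (suc n)} {L} → LamPremises t Γ L → ℕ
  nAppL lnil         = 0
  nAppL (lcons π ps) = nApp π + nAppL ps

data _⊢ₚ_∶_ {n : ℕ} : TyCtx n → Prog n → MTy → Set where
  esε : ∀ {Γ t M} → Γ ⊢ t ∶ M → Γ ⊢ₚ ⟪ t ⟫ ∶ M
  esApp : ∀ {Γ' Δ p i ii M N} →
        Γ' ⊢ₚ p ∶ N → Δ ⊢ i ∶ M → Γ' zero ≈M M →
        (tailᶜ Γ' ⊎ᶜ Δ) ⊢ₚ es p i ii ∶ N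

nAppP : ∀ {n Γ} {p : Prog n} {M} → Γ ⊢ₚ p ∶ M → ℕ
nAppP (esε π)      = nApp π
nAppP (esApp π σ _)  = nAppP π + nApp σ

-- A normal program (t , E) has a fireball t and inert entries in E, and a fireball is
-- typable at 𝟎 (an inert term even at any multi type) using exactly one (@) rule per
-- application node, so q gets a typing with |π| = |q|.  That typing is pulled back
-- along d by subject expansion, each step adding at least one (@) rule: a βi step is
-- undone by re-assembling the redex (λx.t) i from the typing of the entry [x ← i]; a
-- βv step by anti-substitution, which collects the typings of the copies of v into a
-- single typing of v — possible because the typings of a value at M₁ and at M₂ merge
-- into one at M₁ ⊎ M₂, with additive size.
module Submission where

open import Defs
open import Algebra.Bundles using (CommutativeMonoid)
open import Data.Empty using (⊥-elim)
open import Data.Fin using (Fin; zero; suc; fromℕ; _↑ˡ_; punchIn; _≟_)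
open import Data.Fin.Properties
  using (suc-injective; punchIn-injective; punchInᵢ≢i; punchIn-punchOut)
open import Data.List using ([]; _∷_; _++_; [_])
open import Data.List.Properties using (++-assoc; ++-identityʳ)
open import Data.List.Relation.Binary.Permutation.Propositional as ↭
  using (_↭_; ↭-sym; ↭-trans; ↭-reflexive)
open import Data.List.Relation.Binary.Permutation.Propositional.Properties
  using (++⁺; ++⁺ˡ; ++⁺ʳ; ++-commutativeMonoid)
import Data.List.Relation.Binary.Permutation.Homogeneous as Perm
import Data.List.Relation.Binary.Pointwise.Base as Pointwise
open import Data.Nat using (ℕ; zero; suc; _+_; _≤_; _<_; z≤n; s≤s)
open import Data.Nat.Properties
  using (≤-reflexive; ≤-trans; ≤-<-trans; +-mono-≤; +-monoˡ-<; +-monoʳ-<;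
         +-identityʳ; +-assoc; +-comm; +-commutativeSemigroup)
open import Data.Product using (Σ; _,_; _×_)
open import Data.Sum using (_⊎_; inj₁; inj₂)
open import Function using (_∘_)
open import Function.Definitions using (Injective)
open import Relation.Binary.PropositionalEquality
  using (_≡_; _≢_; refl; sym; trans; cong; cong₂; subst)
open import Relation.Nullary using (yes; no)

import Algebra.Properties.CommutativeSemigroup as CommutativeSemigroupProperties
module ℕ+ = CommutativeSemigroupProperties +-commutativeSemigroup
module ↭++ {A : Set} = CommutativeSemigroupProperties
  (CommutativeMonoid.commutativeSemigroup (++-commutativeMonoid {A = A}))

mutual
  ≈L-refl : ∀ L → L ≈L L
  ≈L-refl (M ⊸ N) = ⊸-cong (≈M-refl M) (≈M-refl N)

  ≈M-refl : ∀ M → M ≈M M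
  ≈M-refl M = Perm.refl (pointwise-refl M)

  pointwise-refl : ∀ M → Pointwise.Pointwise _≈L_ M M
  pointwise-refl []      = Pointwise.[]
  pointwise-refl (L ∷ M) = ≈L-refl L Pointwise.∷ pointwise-refl M

≈M-reflexive : ∀ {M N} → M ≡ N → M ≈M N
≈M-reflexive refl = ≈M-refl _

↭⇒≈M : ∀ {M N} → M ↭ N → M ≈M N
↭⇒≈M ↭.refl          = ≈M-refl _
↭⇒≈M (↭.prep L p)    = Perm.prep (≈L-refl L) (↭⇒≈M p)
↭⇒≈M (↭.swap L L′ p) = Perm.swap (≈L-refl L) (≈L-refl L′) (↭⇒≈M p)
↭⇒≈M (↭.trans p q)   = Perm.trans (↭⇒≈M p) (↭⇒≈M q)

_≃ᶜ_ : ∀ {n} → TyCtx n → TyCtx n → Set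
Γ ≃ᶜ Δ = ∀ x → Γ x ↭ Δ x

↦-self : ∀ {n} (x : Fin n) M → (x ↦ M) x ≡ M
↦-self zero    M = refl
↦-self (suc x) M = ↦-self x M

↦-other : ∀ {n} {x y : Fin n} M → x ≢ y → (x ↦ M) y ≡ 𝟎
↦-other {x = zero}  {zero}  M x≢y = ⊥-elim (x≢y refl)
↦-other {x = zero}  {suc y} M x≢y = refl
↦-other {x = suc x} {zero}  M x≢y = refl
↦-other {x = suc x} {suc y} M x≢y = ↦-other M (x≢y ∘ cong suc)

↦-reindex : ∀ {n m} {ρ : Fin n → Fin m} → Injective _≡_ _≡_ ρ →
            ∀ x y M → (ρ x ↦ M) (ρ y) ≡ (x ↦ M) y
↦-reindex {ρ = ρ} ρ-inj x y M with x ≟ y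
... | yes refl = trans (↦-self (ρ x) M) (sym (↦-self x M))
... | no x≢y   = trans (↦-other M (x≢y ∘ ρ-inj)) (sym (↦-other M x≢y))

↦-++ : ∀ {n} (x y : Fin n) M N → (x ↦ (M ++ N)) y ≡ (x ↦ M) y ++ (x ↦ N) y
↦-++ zero    zero    M N = refl
↦-++ zero    (suc y) M N = refl
↦-++ (suc x) zero    M N = refl
↦-++ (suc x) (suc y) M N = ↦-++ x y M N

↦-𝟎 : ∀ {n} (x y : Fin n) → (x ↦ 𝟎) y ≡ 𝟎
↦-𝟎 x y with x ≟ y
... | yes refl = ↦-self x 𝟎
... | no x≢y   = ↦-other 𝟎 x≢y

lcons-≡ : ∀ {n} {t : Tm (suc n)} {Γ′ Δ M N L} → Γ′ zero ≡ M →
          Γ′ ⊢ t ∶ N → LamPremises t Δ L → LamPremises t (tailᶜ Γ′ ⊎ᶜ Δ) ((M ⊸ N) ∷ L)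
lcons-≡ refl = lcons

nAppL-lcons-≡ : ∀ {n} {t : Tm (suc n)} {Γ′ Δ M N L} (e : Γ′ zero ≡ M)
                (π : Γ′ ⊢ t ∶ N) (ps : LamPremises t Δ L) →
                nAppL (lcons-≡ e π ps) ≡ nApp π + nAppL ps
nAppL-lcons-≡ refl π ps = refl

value-⊢-𝟎 : ∀ {n} {v : Tm n} → Value v → Σ (TyCtx n) λ Δ → (Δ ⊢ v ∶ 𝟎) × (∀ x → Δ x ≡ 𝟎)
value-⊢-𝟎 (v-var y) = (y ↦ 𝟎) , ax y 𝟎 , ↦-𝟎 y
value-⊢-𝟎 (v-lam t) = emptyᶜ , abs lnil , (λ _ → refl)

LamPremises-++ : ∀ {n} {t : Tm (suc n)} {Δ₁ Δ₂ L₁ L₂}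
                 (ps₁ : LamPremises t Δ₁ L₁) (ps₂ : LamPremises t Δ₂ L₂) →
                 Σ (TyCtx n) λ Δ → Σ (LamPremises t Δ (L₁ ++ L₂)) λ ps →
                 (∀ x → Δ x ≡ Δ₁ x ++ Δ₂ x) × nAppL ps ≡ nAppL ps₁ + nAppL ps₂
LamPremises-++ lnil ps₂ = _ , ps₂ , (λ _ → refl) , refl
LamPremises-++ (lcons {Γ′} π ps₁) ps₂ with LamPremises-++ ps₁ ps₂
... | Δ , ps , Δ≡ , size≡ =
  tailᶜ Γ′ ⊎ᶜ Δ , lcons π ps ,
  (λ x → trans (cong (Γ′ (suc x) ++_) (Δ≡ x)) (sym (++-assoc (Γ′ (suc x)) _ _))) ,
  trans (cong (nApp π +_) size≡) (sym (+-assoc (nApp π) _ _))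

value-⊢-++ : ∀ {n} {v : Tm n} → Value v → ∀ {Δ₁ Δ₂ K₁ K₂} (σ₁ : Δ₁ ⊢ v ∶ K₁) (σ₂ : Δ₂ ⊢ v ∶ K₂) →
             Σ (TyCtx n) λ Δ → Σ (Δ ⊢ v ∶ (K₁ ++ K₂)) λ σ →
             (∀ x → Δ x ≡ Δ₁ x ++ Δ₂ x) × nApp σ ≡ nApp σ₁ + nApp σ₂
value-⊢-++ (v-var y) (ax _ K₁) (ax _ K₂) = _ , ax y (K₁ ++ K₂) , (λ x → ↦-++ y x K₁ K₂) , refl
value-⊢-++ (v-lam t) (abs ps₁) (abs ps₂) with LamPremises-++ ps₁ ps₂
... | Δ , ps , Δ≡ , size≡ = Δ , abs ps , Δ≡ , size≡

ext-injective : ∀ {n m} {ρ : Fin n → Fin m} → Injective _≡_ _≡_ ρ → Injective _≡_ _≡_ (ext ρ)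
ext-injective ρ-inj {zero}  {zero}  _ = refl
ext-injective ρ-inj {suc x} {suc y} e = cong suc (ρ-inj (suc-injective e))

ext-≢-suc : ∀ {n m} {ρ : Fin n → Fin m} {y} → (∀ x → ρ x ≢ y) → ∀ x → ext ρ x ≢ suc y
ext-≢-suc ρ≢y zero    ()
ext-≢-suc ρ≢y (suc x) e = ρ≢y x (suc-injective e)

record RenInversion {n m} (ρ : Fin n → Fin m) (Γ : TyCtx m) (J : TyCtx n → Set)
                    (size : ∀ {Δ} → J Δ → ℕ) (k : ℕ) : Set₁ where
  constructor ren-inv
  field
    Δ         : TyCtx n
    ⊢u        : J Δ
    on-image  : ∀ x → Γ (ρ x) ≡ Δ x
    off-image : ∀ y → (∀ x → ρ x ≢ y) → Γ y ≡ 𝟎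
    size≡     : size ⊢u ≡ k

mutual
  ren-inversion : ∀ {n m} {ρ : Fin n → Fin m} → Injective _≡_ _≡_ ρ →
                  ∀ u {Γ N} (π : Γ ⊢ ren ρ u ∶ N) → RenInversion ρ Γ (_⊢ u ∶ N) nApp (nApp π)
  ren-inversion ρ-inj (var x) (ax _ N) =
    ren-inv (x ↦ N) (ax x N) (λ y → ↦-reindex ρ-inj x y N) (λ y ρ≢y → ↦-other N (ρ≢y x)) refl
  ren-inversion ρ-inj (t · u) (app π₁ π₂ M≈)
    with ren-inversion ρ-inj t π₁ | ren-inversion ρ-inj u π₂
  ... | ren-inv Δ₁ ⊢t on₁ off₁ size₁ | ren-inv Δ₂ ⊢u on₂ off₂ size₂ =
    ren-inv (Δ₁ ⊎ᶜ Δ₂) (app ⊢t ⊢u M≈) (λ x → cong₂ _++_ (on₁ x) (on₂ x))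
      (λ y ρ≢y → cong₂ _++_ (off₁ y ρ≢y) (off₂ y ρ≢y)) (cong suc (cong₂ _+_ size₁ size₂))
  ren-inversion ρ-inj (lam b) (abs ps) with ren-inversionᴸ ρ-inj b ps
  ... | ren-inv Δ ⊢ps on off size = ren-inv Δ (abs ⊢ps) on off size

  ren-inversionᴸ : ∀ {n m} {ρ : Fin n → Fin m} → Injective _≡_ _≡_ ρ →
                   ∀ b {Γ L} (ps : LamPremises (ren (ext ρ) b) Γ L) →
                   RenInversion ρ Γ (λ Δ → LamPremises b Δ L) nAppL (nAppL ps)
  ren-inversionᴸ ρ-inj b lnil = ren-inv emptyᶜ lnil (λ _ → refl) (λ _ _ → refl) refl
  ren-inversionᴸ ρ-inj b (lcons π ps)
    with ren-inversion (ext-injective ρ-inj) b π | ren-inversionᴸ ρ-inj b ps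
  ... | ren-inv Δ₁ ⊢b on₁ off₁ size₁ | ren-inv Δ₂ ⊢ps on₂ off₂ size₂ =
    ren-inv (tailᶜ Δ₁ ⊎ᶜ Δ₂) (lcons-≡ (sym (on₁ zero)) ⊢b ⊢ps)
      (λ x → cong₂ _++_ (on₁ (suc x)) (on₂ x))
      (λ y ρ≢y → cong₂ _++_ (off₁ (suc y) (ext-≢-suc ρ≢y)) (off₂ y ρ≢y))
      (trans (nAppL-lcons-≡ (sym (on₁ zero)) ⊢b ⊢ps) (cong₂ _+_ size₁ size₂))

weaken : ∀ j {n} → Tm n → Tm (j + n)
weaken zero    v = v
weaken (suc j) v = ren suc (weaken j v)

weakenᶜ : ∀ j {n} → TyCtx n → TyCtx (j + n)
weakenᶜ zero    Δ         = Δ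
weakenᶜ (suc j) Δ zero    = 𝟎
weakenᶜ (suc j) Δ (suc x) = weakenᶜ j Δ x

weakenᶜ-↑ˡ : ∀ j {n} (Δ : TyCtx n) (x : Fin j) → weakenᶜ j Δ (x ↑ˡ n) ≡ 𝟎
weakenᶜ-↑ˡ (suc j) Δ zero    = refl
weakenᶜ-↑ˡ (suc j) Δ (suc x) = weakenᶜ-↑ˡ j Δ x

weakenᶜ-𝟎 : ∀ j {n} {Δ : TyCtx n} → (∀ x → Δ x ≡ 𝟎) → ∀ x → weakenᶜ j Δ x ≡ 𝟎
weakenᶜ-𝟎 zero    Δ≡𝟎 x       = Δ≡𝟎 x
weakenᶜ-𝟎 (suc j) Δ≡𝟎 zero    = refl
weakenᶜ-𝟎 (suc j) Δ≡𝟎 (suc x) = weakenᶜ-𝟎 j Δ≡𝟎 x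

weakenᶜ-⊎ : ∀ j {n} {Δ Δ₁ Δ₂ : TyCtx n} → (∀ x → Δ x ≡ Δ₁ x ++ Δ₂ x) →
            ∀ x → weakenᶜ j Δ x ≡ weakenᶜ j Δ₁ x ++ weakenᶜ j Δ₂ x
weakenᶜ-⊎ zero    Δ≡ x       = Δ≡ x
weakenᶜ-⊎ (suc j) Δ≡ zero    = refl
weakenᶜ-⊎ (suc j) Δ≡ (suc x) = weakenᶜ-⊎ j Δ≡ x

weaken-inversion : ∀ j {n} (v : Tm n) {Γ N} (π : Γ ⊢ weaken j v ∶ N) →
                   Σ (TyCtx n) λ Δ → Σ (Δ ⊢ v ∶ N) λ σ →
                   (∀ x → Γ x ≡ weakenᶜ j Δ x) × nApp σ ≡ nApp π
weaken-inversion zero    v π = _ , π , (λ _ → refl) , refl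
weaken-inversion (suc j) v {Γ} π with ren-inversion suc-injective (weaken j v) π
... | ren-inv Δ₁ π₁ on off size with weaken-inversion j v π₁
... | Δ , σ , Γ₁≡ , size₁ = Δ , σ , Γ≡ , trans size₁ size
  where
  Γ≡ : ∀ x → Γ x ≡ weakenᶜ (suc j) Δ x
  Γ≡ zero    = off zero (λ _ ())
  Γ≡ (suc x) = trans (on x) (Γ₁≡ x)

-- Below j binders the substituted variable is pos j; the other variables are
-- punchIn (pos j) y, and those with y = x ↑ˡ n (x : Fin j) are the binders.
pos : ∀ j {n} → Fin (suc (j + n))
pos j {n} = fromℕ j ↑ˡ n

single↑ : ∀ j {n} → Tm n → Fin (suc (j + n)) → Tm (j + n)
single↑ zero    v = single v
single↑ (suc j) v = exts (single↑ j v)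

single↑-pos : ∀ j {n} (v : Tm n) → single↑ j v (pos j) ≡ weaken j v
single↑-pos zero    v = refl
single↑-pos (suc j) v = cong (ren suc) (single↑-pos j v)

single↑-punchIn : ∀ j {n} (v : Tm n) y → single↑ j v (punchIn (pos j) y) ≡ var y
single↑-punchIn zero    v y       = refl
single↑-punchIn (suc j) v zero    = refl
single↑-punchIn (suc j) v (suc y) = cong (ren suc) (single↑-punchIn j v y)

data PosView j {n} : Fin (suc (j + n)) → Set where
  at-pos  : PosView j (pos j)
  off-pos : ∀ y → PosView j (punchIn (pos j) y)

posView : ∀ j {n} (x : Fin (suc (j + n))) → PosView j x
posView j x with pos j ≟ x
... | yes refl  = at-pos
... | no pos≢x = subst (PosView j) (punchIn-punchOut pos≢x) (off-pos _)

-- The binders field is an equation, not a permutation, because rule (λ) fixes the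
-- multi type of its bound variable exactly.
record SubInversion j {n} (v : Tm n) (Γ : TyCtx (j + n)) (J : TyCtx (suc (j + n)) → Set)
                    (size : ∀ {Γ′} → J Γ′ → ℕ) (k : ℕ) : Set₁ where
  constructor sub-inv
  field
    Γ′      : TyCtx (suc (j + n))
    Δ       : TyCtx n
    ⊢t      : J Γ′
    K       : MTy
    ⊢v      : Δ ⊢ v ∶ K
    K≡      : K ≡ Γ′ (pos j)
    split   : ∀ x → Γ x ↭ Γ′ (punchIn (pos j) x) ++ weakenᶜ j Δ x
    binders : ∀ (x : Fin j) → Γ (x ↑ˡ n) ≡ Γ′ (punchIn (pos j) (x ↑ˡ n))
    size≤   : k ≤ size ⊢t + nApp ⊢v

split-⊎ : ∀ j {n} {Δ Δ₁ Δ₂ : TyCtx n} → (∀ x → Δ x ≡ Δ₁ x ++ Δ₂ x) → ∀ {x} {A₁ A₂ B₁ B₂} →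
          A₁ ↭ B₁ ++ weakenᶜ j Δ₁ x → A₂ ↭ B₂ ++ weakenᶜ j Δ₂ x →
          A₁ ++ A₂ ↭ (B₁ ++ B₂) ++ weakenᶜ j Δ x
split-⊎ j Δ≡ {x} {B₁ = B₁} {B₂} split₁ split₂ =
  ↭-trans (++⁺ split₁ split₂)
    (↭-trans (↭++.interchange B₁ (weakenᶜ j _ x) B₂ (weakenᶜ j _ x))
      (↭-reflexive (cong ((B₁ ++ B₂) ++_) (sym (weakenᶜ-⊎ j Δ≡ x)))))

size-⊎ : ∀ a₁ b₁ a₂ b₂ {k₁ k₂ b} → k₁ ≤ a₁ + b₁ → k₂ ≤ a₂ + b₂ → b ≡ b₁ + b₂ →
         k₁ + k₂ ≤ (a₁ + a₂) + b
size-⊎ a₁ b₁ a₂ b₂ size₁ size₂ refl =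
  ≤-trans (+-mono-≤ size₁ size₂) (≤-reflexive (ℕ+.interchange a₁ b₁ a₂ b₂))

at-pos-inversion : ∀ j {n} {v : Tm n} {s Γ N} → s ≡ weaken j v → (π : Γ ⊢ s ∶ N) →
                   SubInversion j v Γ (_⊢ var (pos j) ∶ N) nApp (nApp π)
at-pos-inversion j {n} {v} {Γ = Γ} {N} refl π with weaken-inversion j v π
... | Δ , σ , Γ≡ , size≡ =
  sub-inv (pos j ↦ N) Δ (ax (pos j) N) N σ (sym (↦-self (pos j) N)) split binders
    (≤-reflexive (sym size≡))
  where
  off-pos-𝟎 : ∀ x → (pos j ↦ N) (punchIn (pos j) x) ≡ 𝟎
  off-pos-𝟎 x = ↦-other N (punchInᵢ≢i (pos j) x ∘ sym)
  split : ∀ x → Γ x ↭ (pos j ↦ N) (punchIn (pos j) x) ++ weakenᶜ j Δ x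
  split x = ↭-reflexive (trans (Γ≡ x) (cong (_++ weakenᶜ j Δ x) (sym (off-pos-𝟎 x))))
  binders : ∀ (x : Fin j) → Γ (x ↑ˡ n) ≡ (pos j ↦ N) (punchIn (pos j) (x ↑ˡ n))
  binders x = trans (Γ≡ (x ↑ˡ n)) (trans (weakenᶜ-↑ˡ j Δ x) (sym (off-pos-𝟎 _)))

off-pos-inversion : ∀ j {n} {v : Tm n} → Value v → ∀ y {s Γ N} → s ≡ var y → (π : Γ ⊢ s ∶ N) →
                    SubInversion j v Γ (_⊢ var (punchIn (pos j) y) ∶ N) nApp (nApp π)
off-pos-inversion j {n} vv y refl (ax _ N) with value-⊢-𝟎 vv
... | Δ , σ , Δ≡𝟎 =
  sub-inv (punchIn (pos j) y ↦ N) Δ (ax _ N) 𝟎 σ (sym (↦-other N (punchInᵢ≢i (pos j) y)))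
    split (λ x → sym (reindex (x ↑ˡ n))) z≤n
  where
  reindex : ∀ x → (punchIn (pos j) y ↦ N) (punchIn (pos j) x) ≡ (y ↦ N) x
  reindex x = ↦-reindex (λ {a} {b} → punchIn-injective (pos j) a b) y x N
  split : ∀ x → (y ↦ N) x ↭ (punchIn (pos j) y ↦ N) (punchIn (pos j) x) ++ weakenᶜ j Δ x
  split x = ↭-reflexive (sym (trans (cong (_ ++_) (weakenᶜ-𝟎 j Δ≡𝟎 x))
                                    (trans (++-identityʳ _) (reindex x))))

mutual
  sub-inversion : ∀ j {n} {v : Tm n} → Value v → ∀ t {Γ N} (π : Γ ⊢ sub (single↑ j v) t ∶ N) →
                  SubInversion j v Γ (_⊢ t ∶ N) nApp (nApp π)
  sub-inversion j vv (var x) π with posView j x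
  ... | at-pos    = at-pos-inversion j (single↑-pos j _) π
  ... | off-pos y = off-pos-inversion j vv y (single↑-punchIn j _ y) π
  sub-inversion j vv (t · u) (app π₁ π₂ M≈)
    with sub-inversion j vv t π₁ | sub-inversion j vv u π₂
  ... | sub-inv Γ₁ Δ₁ ⊢t K₁ ⊢v₁ K₁≡ split₁ binders₁ size₁
      | sub-inv Γ₂ Δ₂ ⊢u K₂ ⊢v₂ K₂≡ split₂ binders₂ size₂
    with value-⊢-++ vv ⊢v₁ ⊢v₂
  ... | Δ , ⊢v , Δ≡ , size≡ =
    sub-inv (Γ₁ ⊎ᶜ Γ₂) Δ (app ⊢t ⊢u M≈) (K₁ ++ K₂) ⊢v (cong₂ _++_ K₁≡ K₂≡)
      (λ x → split-⊎ j Δ≡ (split₁ x) (split₂ x))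
      (λ x → cong₂ _++_ (binders₁ x) (binders₂ x))
      (s≤s (size-⊎ (nApp ⊢t) (nApp ⊢v₁) (nApp ⊢u) (nApp ⊢v₂) size₁ size₂ size≡))
  sub-inversion j vv (lam b) (abs ps) with sub-inversionᴸ j vv b ps
  ... | sub-inv Γ′ Δ ⊢ps K ⊢v K≡ split binders size≤ =
    sub-inv Γ′ Δ (abs ⊢ps) K ⊢v K≡ split binders size≤

  sub-inversionᴸ : ∀ j {n} {v : Tm n} → Value v →
                   ∀ b {Γ L} (ps : LamPremises (sub (single↑ (suc j) v) b) Γ L) →
                   SubInversion j v Γ (λ Γ′ → LamPremises b Γ′ L) nAppL (nAppL ps)
  sub-inversionᴸ j vv b lnil with value-⊢-𝟎 vv
  ... | Δ , σ , Δ≡𝟎 =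
    sub-inv emptyᶜ Δ lnil 𝟎 σ refl (λ x → ↭-reflexive (sym (weakenᶜ-𝟎 j Δ≡𝟎 x))) (λ _ → refl) z≤n
  sub-inversionᴸ j vv b (lcons {Γ} π ps)
    with sub-inversion (suc j) vv b π | sub-inversionᴸ j vv b ps
  ... | sub-inv Γ₁ Δ₁ ⊢b K₁ ⊢v₁ K₁≡ split₁ binders₁ size₁
      | sub-inv Γ₂ Δ₂ ⊢ps K₂ ⊢v₂ K₂≡ split₂ binders₂ size₂
    with value-⊢-++ vv ⊢v₁ ⊢v₂
  ... | Δ , ⊢v , Δ≡ , size≡ =
    sub-inv (tailᶜ Γ₁ ⊎ᶜ Γ₂) Δ (lcons-≡ Γ₁-zero ⊢b ⊢ps) (K₁ ++ K₂) ⊢v (cong₂ _++_ K₁≡ K₂≡)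
      (λ x → split-⊎ j Δ≡ (split₁ (suc x)) (split₂ x))
      (λ x → cong₂ _++_ (binders₁ (suc x)) (binders₂ x))
      (≤-trans (size-⊎ (nApp ⊢b) (nApp ⊢v₁) (nAppL ⊢ps) (nApp ⊢v₂) size₁ size₂ size≡)
               (≤-reflexive (cong (_+ nApp ⊢v) (sym (nAppL-lcons-≡ Γ₁-zero ⊢b ⊢ps)))))
    where
    Γ₁-zero : Γ₁ zero ≡ Γ zero
    Γ₁-zero = sym (binders₁ zero)

record Expansion {n} (J : TyCtx n → Set) (size : ∀ {Γ} → J Γ → ℕ) (Γ : TyCtx n) (k : ℕ) : Set₁ where
  constructor expansion
  field
    Γ′    : TyCtx n
    Γ′≃Γ  : Γ′ ≃ᶜ Γ
    ⊢     : J Γ′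
    grows : k < size ⊢

expansion-mono : ∀ {n} {J : TyCtx n → Set} {size : ∀ {Γ} → J Γ → ℕ} {Γ₁ Γ₂ k₁ k₂} →
                 Γ₁ ≃ᶜ Γ₂ → k₂ ≤ k₁ → Expansion J size Γ₁ k₁ → Expansion J size Γ₂ k₂
expansion-mono Γ₁≃Γ₂ k₂≤k₁ (expansion Γ′ Γ′≃Γ₁ ⊢ grows) =
  expansion Γ′ (λ x → ↭-trans (Γ′≃Γ₁ x) (Γ₁≃Γ₂ x)) ⊢ (≤-<-trans k₂≤k₁ grows)

app-expansionˡ : ∀ {n} {Γ₁ Γ₂ : TyCtx n} {t u M M′ N k} →
                 Expansion (_⊢ t ∶ [ M ⊸ N ]) nApp Γ₁ k → (π₂ : Γ₂ ⊢ u ∶ M′) → M ≈M M′ →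
                 Expansion (_⊢ t · u ∶ N) nApp (Γ₁ ⊎ᶜ Γ₂) (suc (k + nApp π₂))
app-expansionˡ {Γ₂ = Γ₂} (expansion Γ₁′ ≃ π₁ grows) π₂ M≈ =
  expansion (Γ₁′ ⊎ᶜ Γ₂) (λ x → ++⁺ʳ (Γ₂ x) (≃ x)) (app π₁ π₂ M≈) (s≤s (+-monoˡ-< (nApp π₂) grows))

app-expansionʳ : ∀ {n} {Γ₁ Γ₂ : TyCtx n} {t u M M′ N k} →
                 (π₁ : Γ₁ ⊢ t ∶ [ M ⊸ N ]) → M ≈M M′ → Expansion (_⊢ u ∶ M′) nApp Γ₂ k →
                 Expansion (_⊢ t · u ∶ N) nApp (Γ₁ ⊎ᶜ Γ₂) (suc (nApp π₁ + k))
app-expansionʳ {Γ₁ = Γ₁} π₁ M≈ (expansion Γ₂′ ≃ π₂ grows) =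
  expansion (Γ₁ ⊎ᶜ Γ₂′) (λ x → ++⁺ˡ (Γ₁ x) (≃ x)) (app π₁ π₂ M≈) (s≤s (+-monoʳ-< (nApp π₁) grows))

redex-expansion : ∀ {n} {Γ : TyCtx (suc n)} {Δ : TyCtx n} {t u N K} →
                  (π : Γ ⊢ t ∶ N) (σ : Δ ⊢ u ∶ K) → Γ zero ≈M K →
                  Expansion (_⊢ lam t · u ∶ N) nApp (tailᶜ Γ ⊎ᶜ Δ) (nApp π + nApp σ)
redex-expansion {Γ = Γ} {Δ} π σ M≈ =
  expansion _ (λ x → ++⁺ʳ (Δ x) (↭-reflexive (++-identityʳ (Γ (suc x)))))
    (app (abs (lcons π lnil)) σ M≈)
    (s≤s (≤-reflexive (cong (_+ nApp σ) (sym (+-identityʳ (nApp π))))))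

βv-expansion : ∀ {n} {t : Tm (suc n)} {v : Tm n} → Value v →
               ∀ {Γ N} (π : Γ ⊢ t ⟨ v ⟩ ∶ N) → Expansion (_⊢ lam t · v ∶ N) nApp Γ (nApp π)
βv-expansion {t = t} vv π with sub-inversion 0 vv t π
... | sub-inv Γ′ Δ ⊢t K ⊢v K≡ split _ size≤ =
  expansion-mono (λ x → ↭-sym (split x)) size≤ (redex-expansion ⊢t ⊢v (≈M-reflexive (sym K≡)))

plug-expansion : ∀ {n} (C : Ctx n) {s s′ : Tm n} →
                 (∀ {Γ N} (π : Γ ⊢ s ∶ N) → Expansion (_⊢ s′ ∶ N) nApp Γ (nApp π)) →
                 ∀ {Γ N} (π : Γ ⊢ plug C s ∶ N) → Expansion (_⊢ plug C s′ ∶ N) nApp Γ (nApp π)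
plug-expansion hole     expand π                = expand π
plug-expansion (t ·ᶜ C) expand (app π₁ π₂ M≈) = app-expansionʳ π₁ M≈ (plug-expansion C expand π₂)
plug-expansion (C ᶜ· u) expand (app π₁ π₂ M≈) = app-expansionˡ (plug-expansion C expand π₁) π₂ M≈

-- The side terms of renC suc C do not mention the variable bound by the βi step, so
-- by ren-inversion their typings leave it untyped and lift to typings of those of C.
βi-expansion : ∀ {n} (C : Ctx n) {t : Tm (suc n)} {i : Tm n} {Δ K} (σ : Δ ⊢ i ∶ K)
               {Γ N} (π : Γ ⊢ plug (renC suc C) t ∶ N) → Γ zero ≈M K →
               Expansion (_⊢ plug C (lam t · i) ∶ N) nApp (tailᶜ Γ ⊎ᶜ Δ) (nApp π + nApp σ)
βi-expansion hole σ π M≈ = redex-expansion π σ M≈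
βi-expansion (u ·ᶜ C) {Δ = Δ} σ (app {Γ = Γ₁} {Δ = Γ₂} π₁ π₂ M≈′) M≈
  with ren-inversion suc-injective u π₁
... | ren-inv Δ₁ π₁′ on off size≡ =
  expansion-mono Γ≃ (≤-reflexive size≡′)
    (app-expansionʳ π₁′ M≈′ (βi-expansion C σ π₂ (subst (_≈M _) (cong (_++ Γ₂ zero) Γ₁-zero) M≈)))
  where
  Γ₁-zero : Γ₁ zero ≡ 𝟎
  Γ₁-zero = off zero (λ _ ())
  Γ≃ : ∀ x → Δ₁ x ++ (Γ₂ (suc x) ++ Δ x) ↭ (Γ₁ (suc x) ++ Γ₂ (suc x)) ++ Δ x
  Γ≃ x = ↭-reflexive (trans (cong (_++ _) (sym (on x))) (sym (++-assoc (Γ₁ (suc x)) _ _)))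
  size≡′ : suc (nApp π₁ + nApp π₂) + nApp σ ≡ suc (nApp π₁′ + (nApp π₂ + nApp σ))
  size≡′ = cong suc (trans (+-assoc (nApp π₁) _ _) (cong (_+ _) (sym size≡)))
βi-expansion (C ᶜ· f) {Δ = Δ} σ (app {Γ = Γ₁} {Δ = Γ₂} π₁ π₂ M≈′) M≈
  with ren-inversion suc-injective f π₂
... | ren-inv Δ₂ π₂′ on off size≡ =
  expansion-mono Γ≃ (≤-reflexive size≡′)
    (app-expansionˡ (βi-expansion C σ π₁ (subst (_≈M _) Γ-zero M≈)) π₂′ M≈′)
  where
  Γ-zero : Γ₁ zero ++ Γ₂ zero ≡ Γ₁ zero
  Γ-zero = trans (cong (Γ₁ zero ++_) (off zero (λ _ ()))) (++-identityʳ (Γ₁ zero))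
  Γ≃ : ∀ x → (Γ₁ (suc x) ++ Δ x) ++ Δ₂ x ↭ (Γ₁ (suc x) ++ Γ₂ (suc x)) ++ Δ x
  Γ≃ x = ↭-trans (↭-reflexive (cong (_ ++_) (sym (on x)))) (↭++.xy∙z≈xz∙y (Γ₁ (suc x)) (Δ x) _)
  size≡′ : suc (nApp π₁ + nApp π₂) + nApp σ ≡ suc (nApp π₁ + nApp σ + nApp π₂′)
  size≡′ = cong suc (trans (ℕ+.xy∙z≈xz∙y (nApp π₁) _ _) (cong (_ +_) (sym size≡)))

subject-expansion : ∀ {n} {p q : Prog n} → p ⟶ q → ∀ {Γ M} (π : Γ ⊢ₚ q ∶ M) →
                    Expansion (_⊢ₚ p ∶ M) nAppP Γ (nAppP π)
subject-expansion (βv {C = C} _ vv) (esε π) with plug-expansion C (βv-expansion vv) π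
... | expansion Γ′ ≃ π′ grows = expansion Γ′ ≃ (esε π′) grows
subject-expansion (βi {C = C} _ _) (esApp (esε π) σ M≈) with βi-expansion C σ π M≈
... | expansion Γ′ ≃ π′ grows = expansion Γ′ ≃ (esε π′) grows
subject-expansion (under s) (esApp {Δ = Δ} π σ M≈) with subject-expansion s π
... | expansion Γ′ ≃ π′ grows =
  expansion (tailᶜ Γ′ ⊎ᶜ Δ) (λ x → ++⁺ʳ (Δ x) (≃ (suc x)))
    (esApp π′ σ (Perm.trans (↭⇒≈M (≃ zero)) M≈)) (+-monoˡ-< (nApp σ) grows)

record Redex {n} (t : Tm n) : Set where
  constructor redex
  field
    C          : Ctx n
    evaluation : EvalCtx C
    body       : Tm (suc n)
    argument   : Tm n
    fireball   : Fireball argument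
    t≡         : t ≡ plug C (lam body · argument)

fireball-or-redex : ∀ {n} (t : Tm n) → Fireball t ⊎ Redex t
fireball-or-redex (var x) = inj₁ (f-val (v-var x))
fireball-or-redex (lam b) = inj₁ (f-val (v-lam b))
fireball-or-redex (t · u) with fireball-or-redex u
... | inj₂ (redex C ev b w fw refl) = inj₂ (redex (t ·ᶜ C) (e-right t ev) b w fw refl)
... | inj₁ fu with fireball-or-redex t
...   | inj₂ (redex C ev b w fw refl) = inj₂ (redex (C ᶜ· u) (e-left ev fu) b w fw refl)
...   | inj₁ (f-val (v-var x))        = inj₁ (f-inert (i-var x fu))
...   | inj₁ (f-val (v-lam b))        = inj₂ (redex hole e-hole b u fu refl)
...   | inj₁ (f-inert it)             = inj₁ (f-inert (i-app it fu))

redex-reduces : ∀ {n} {t : Tm n} → Redex t → Σ (Prog n) (⟪ t ⟫ ⟶_)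
redex-reduces (redex C ev b w (f-val vv)   refl) = _ , βv ev vv
redex-reduces (redex C ev b w (f-inert ii) refl) = _ , βi ev ii

normal-fireball : ∀ {n} {t : Tm n} → Normal ⟪ t ⟫ → Fireball t
normal-fireball {t = t} nf with fireball-or-redex t
... | inj₁ ft = ft
... | inj₂ r  = ⊥-elim (nf (redex-reduces r))

tsize-app : ∀ {n} (t u : Tm n) {a b} → tsize t ≡ a → tsize u ≡ b → tsize (t · u) ≡ suc (a + b)
tsize-app t u refl refl = +-comm (tsize t + tsize u) 1

mutual
  inert-⊢ : ∀ {n} {i : Tm n} → Inert i → ∀ M →
            Σ (TyCtx n) λ Γ → Σ (Γ ⊢ i ∶ M) λ π → tsize i ≡ nApp π
  inert-⊢ (i-var x {f} ff) M with fireball-⊢𝟎 ff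
  ... | Γ , π , size≡ = _ , app (ax x [ 𝟎 ⊸ M ]) π (≈M-refl 𝟎) , tsize-app (var x) f refl size≡
  inert-⊢ (i-app {i} {f} ii ff) M with fireball-⊢𝟎 ff
  ... | Γ , π , size≡ with inert-⊢ ii [ 𝟎 ⊸ M ]
  ... | Γ′ , π′ , size≡′ = _ , app π′ π (≈M-refl 𝟎) , tsize-app i f size≡′ size≡

  fireball-⊢𝟎 : ∀ {n} {f : Tm n} → Fireball f →
                Σ (TyCtx n) λ Γ → Σ (Γ ⊢ f ∶ 𝟎) λ π → tsize f ≡ nApp π
  fireball-⊢𝟎 (f-val (v-var x)) = _ , ax x 𝟎 , refl
  fireball-⊢𝟎 (f-val (v-lam b)) = _ , abs lnil , refl
  fireball-⊢𝟎 (f-inert ii) = inert-⊢ ii 𝟎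

normal-⊢ₚ : ∀ {n} (q : Prog n) → Normal q →
            Σ (TyCtx n) λ Γ → Σ MTy λ M → Σ (Γ ⊢ₚ q ∶ M) λ π → psize q ≡ nAppP π
normal-⊢ₚ ⟪ t ⟫ nf with fireball-⊢𝟎 (normal-fireball nf)
... | Γ , π , size≡ = Γ , 𝟎 , esε π , size≡
normal-⊢ₚ (es p i ii) nf with normal-⊢ₚ p (λ { (p′ , s) → nf (es p′ i ii , under s) })
... | Γ , M , π , size≡ with inert-⊢ ii (Γ zero)
... | Δ , σ , size≡′ = _ , M , esApp π σ (≈M-refl _) , cong₂ _+_ size≡ size≡′

theorem3 : ∀ {n} {p q : Prog n} (d : p ⟶* q) → Normal q →
           Σ (TyCtx n) λ Γ → Σ MTy λ M → Σ (Γ ⊢ₚ p ∶ M) λ π →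
           len d + psize q ≤ nAppP π
theorem3 {q = q} done nf with normal-⊢ₚ q nf
... | Γ , M , π , size≡ = Γ , M , π , ≤-reflexive size≡
theorem3 (step s d) nf with theorem3 d nf
... | Γ , M , π , bound with subject-expansion s π
... | expansion Γ′ _ π′ grows = Γ′ , M , π′ , ≤-trans (s≤s bound) grows
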